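{- Let $\Lambda$ be a finite set and let $(g(\lambda)\mid\lambda\in\Lambda)\in\Omega^{\Lambda}$ be a family of monic polynomials; for each $\lambda\in\Lambda$ let $\theta(\lambda)$ be the greatest element of $\mathrm{supp}(g(\lambda))$. Let $Q$ be an ideal of $\Omega$ with $\{g(\lambda)\mid\lambda\in\Lambda\}\subseteq Q$. Then the following six statements are equivalent: (1) $(g(\lambda)\mid\lambda\in\Lambda)$ is a Gröbner basis of $Q$; (2) $Q\cap\delta(\mathbb{N}^{n}\setminus\nabla(\{\theta(\lambda)\mid\lambda\in\Lambda\}))=\{0\}$; (3) for every $f\in Q$ there exists $(p(\lambda)\mid\lambda\in\Lambda)\in\Omega^{\Lambda}$ with $f=\sum_{\lambda\in\Lambda}p(\lambda)g(\lambda)$ and $\mathrm{supp}(p(\lambda))+\mathrm{supp}(g(\lambda))\subseteq\Delta(\mathrm{supp}(f))$ for all $\lambda\in\Lambda$; (4) for every $f\in Q$ and every $\beta\in\max(\mathrm{supp}(f))$ there exists $\xi\in\Lambda$ with $\theta(\xi)\leqslant\beta$ (equivalently: every $h\in\Omega$ for which some $\gamma\in\max(\mathrm{supp}(h))$ satisfies $\theta(\lambda)\not\leqslant\gamma$ for all $\lambda\in\Lambda$ is not in $Q$); (5) for every $f\in Q$ there exists $(p(\lambda)\mid\lambda\in\Lambda)\in\Omega^{\Lambda}$ with $f=\sum_{\lambda\in\Lambda}p(\lambda)g(\lambda)$ and $\deg(p(\lambda))+\deg(g(\lambda))\leqslant\deg(f)$ for all $\lambda\in\Lambda$; (6) for every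 $f\in Q\setminus\{0\}$ and every $\beta\in\mathrm{supp}(f)$ with $\deg(f)=\sum_{i=1}^n\beta_i$ there exists $\xi\in\Lambda$ with $\theta(\xi)\leqslant\beta$ (equivalently: every nonzero $h\in\Omega$ for which some $\gamma\in\mathrm{supp}(h)$ satisfies $\deg(h)=\sum_i\gamma_i$ and $\theta(\lambda)\not\leqslant\gamma$ for all $\lambda\in\Lambda$ is not in $Q$).
   Context: Let $R$ be a commutative ring with identity $1_R$, $n$ a positive integer, $\mathbb{N}=\{0,1,2,\dots\}$, and $\Omega=R[x_1,\dots,x_n]$. For $\alpha,\beta\in\mathbb{N}^n$, $\alpha\leqslant\beta$ means $\alpha_i\leqslant\beta_i$ for all $i$; addition is componentwise. For $f\in\Omega$ and $\alpha\in\mathbb{N}^n$, $f_{[\alpha]}$ denotes the coefficient of $x_1^{\alpha_1}\cdots x_n^{\alpha_n}$ in $f$, $\mathrm{supp}(f)=\{\alpha\in\mathbb{N}^n: f_{[\alpha]}\neq0\}$, and $\deg$ is total degree. For $A,B\subseteq\mathbb{N}^n$: $\Delta(A)=\{\beta:\exists\alpha\in A,\ \beta\leqslant\alpha\}$, $\nabla(A)=\{\beta:\exists\alpha\in A,\ \alpha\leqslant\beta\}$, $\max(A)=\{\beta\in A:\forall\alpha\in A,\ \beta\leqslant\alpha\Rightarrow\beta=\alpha\}$, $A+B=\{\alpha+\beta:\alpha\in A,\beta\in B\}$, and $\delta(A)=\{f\in\Omega:\mathrm{supp}(f)\subseteq A\}$. A polynomial $g\in\Omega$ is monic if $\mathrm{supp}(g)$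 has a greatest element $\theta$ for $\leqslant$ (i.e. $\theta\in\mathrm{supp}(g)$ and $\gamma\leqslant\theta$ for all $\gamma\in\mathrm{supp}(g)$) and $g_{[\theta]}=1_R$. Given a finite set $\Lambda$, a family $(g(\lambda))_{\lambda\in\Lambda}$ of monic polynomials with greatest support elements $\theta(\lambda)$, and an ideal $Q$ containing all $g(\lambda)$, the family is called a Gröbner basis of $Q$ if for every $\tau\in Q\setminus\{0\}$ there exist $\alpha\in\mathrm{supp}(\tau)$ and $r\in\Lambda$ with $\theta(r)\leqslant\alpha$. -}

module Defs where

open import Level using (Level; _⊔_) renaming (suc to lsuc)
open import Algebra.Bundles using (CommutativeRing)
open import Data.Nat as ℕ using (ℕ)
open import Data.Fin using (Fin)
open import Data.Vec using (Vec; lookup; zipWith; sum)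
open import Data.Vec.Properties using (≡-dec)
open import Data.List using (List; []; _∷_; _++_; concatMap; map)
open import Data.Product using (Σ; ∃; ∃-syntax; _×_; _,_)
open import Relation.Nullary using (¬_; yes; no)
open import Relation.Binary.PropositionalEquality using (_≡_)

Exp : ℕ → Set
Exp n = Vec ℕ n

_≤ₑ_ : ∀ {n} → Exp n → Exp n → Set
α ≤ₑ β = ∀ i → lookup α i ℕ.≤ lookup β i

_+ₑ_ : ∀ {n} → Exp n → Exp n → Exp n
α +ₑ β = zipWith ℕ._+_ α β

∣_∣ₑ : ∀ {n} → Exp n → ℕ
∣ α ∣ₑ = sum α

module Poly {c ℓ : Level} (R : CommutativeRing c ℓ) (n : ℕ) where
  open CommutativeRing R

  -- A polynomial in Ω = R[x₁,…,xₙ], given as a finite formal sum of terms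
  -- c·x^α (duplicate exponents allowed; coefficients are added up).
  Ω : Set c
  Ω = List (Exp n × Carrier)

  coeff : Ω → Exp n → Carrier
  coeff [] α = 0#
  coeff ((β , a) ∷ f) α with ≡-dec ℕ._≟_ β α
  ... | yes _ = a + coeff f α
  ... | no  _ = coeff f α

  _≈ₚ_ : Ω → Ω → Set ℓ
  f ≈ₚ g = ∀ α → coeff f α ≈ coeff g α

  0ₚ : Ω
  0ₚ = []

  _+ₚ_ : Ω → Ω → Ω
  f +ₚ g = f ++ g

  _*ₚ_ : Ω → Ω → Ω
  f *ₚ g = concatMap (λ { (α , a) → map (λ { (β , b) → (α +ₑ β , a * b) }) g }) f

  Σₚ : ∀ {m} → (Fin m → Ω) → Ω
  Σₚ {ℕ.zero}  h = 0ₚ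
  Σₚ {ℕ.suc m} h = h Fin.zero +ₚ Σₚ (λ i → h (Fin.suc i))

  _∈supp_ : Exp n → Ω → Set ℓ
  α ∈supp f = ¬ (coeff f α ≈ 0#)

  _∈maxsupp_ : Exp n → Ω → Set ℓ
  β ∈maxsupp f = β ∈supp f × (∀ α → α ∈supp f → β ≤ₑ α → β ≡ α)

  MonicWith : Ω → Exp n → Set ℓ
  MonicWith g θ = θ ∈supp g × coeff g θ ≈ 1# × (∀ γ → γ ∈supp g → γ ≤ₑ θ)

  IsDeg : Ω → ℕ → Set ℓ
  IsDeg f d = (∃[ β ] (β ∈supp f × ∣ β ∣ₑ ≡ d)) × (∀ γ → γ ∈supp f → ∣ γ ∣ₑ ℕ.≤ d)

  -- deg(p) + deg(g) ≤ deg(f), with the convention deg(0) = -∞: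
  -- unfolded as: every total degree occurring in p plus every one occurring in g
  -- is bounded by some total degree occurring in f.
  DegSumLe : Ω → Ω → Ω → Set ℓ
  DegSumLe p g f = ∀ α → α ∈supp p → ∀ γ → γ ∈supp g →
                   ∃[ β ] (β ∈supp f × ∣ α ∣ₑ ℕ.+ ∣ γ ∣ₑ ℕ.≤ ∣ β ∣ₑ)

  SuppSumInΔ : Ω → Ω → Ω → Set ℓ
  SuppSumInΔ p g f = ∀ α → α ∈supp p → ∀ γ → γ ∈supp g →
                     ∃[ β ] (β ∈supp f × (α +ₑ γ) ≤ₑ β)

  record Ideal (ℓq : Level) : Set (c ⊔ ℓ ⊔ lsuc ℓq) where
    field
      _∈Q       : Ω → Set ℓq
      resp      : ∀ {f g} → f ≈ₚ g → f ∈Q → g ∈Q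
      0∈Q       : 0ₚ ∈Q
      +-closed  : ∀ {f g} → f ∈Q → g ∈Q → (f +ₚ g) ∈Q
      *-closed  : ∀ {f} (h : Ω) → f ∈Q → (h *ₚ f) ∈Q

  module _ {ℓq : Level} {m : ℕ} (Q : Ideal ℓq) (g : Fin m → Ω) (θ : Fin m → Exp n) where
    open Ideal Q

    GroebnerBasis : Set (c ⊔ ℓ ⊔ ℓq)
    GroebnerBasis = ∀ τ → τ ∈Q → ¬ (τ ≈ₚ 0ₚ) →
                    ∃[ α ] (α ∈supp τ × ∃[ r ] (θ r ≤ₑ α))

    Cond2 : Set (c ⊔ ℓ ⊔ ℓq)
    Cond2 = ∀ f → f ∈Q → (∀ α → α ∈supp f → ¬ (∃[ r ] (θ r ≤ₑ α))) → f ≈ₚ 0ₚ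

    Cond3 : Set (c ⊔ ℓ ⊔ ℓq)
    Cond3 = ∀ f → f ∈Q → Σ (Fin m → Ω) λ p → ((f ≈ₚ Σₚ (λ r → p r *ₚ g r)) ×
                                  (∀ r → SuppSumInΔ (p r) (g r) f))

    Cond4 : Set (c ⊔ ℓ ⊔ ℓq)
    Cond4 = ∀ f → f ∈Q → ∀ β → β ∈maxsupp f → ∃[ ξ ] (θ ξ ≤ₑ β)

    Cond5 : Set (c ⊔ ℓ ⊔ ℓq)
    Cond5 = ∀ f → f ∈Q → Σ (Fin m → Ω) λ p → ((f ≈ₚ Σₚ (λ r → p r *ₚ g r)) ×
                                  (∀ r → DegSumLe (p r) (g r) f))

    Cond6 : Set (c ⊔ ℓ ⊔ ℓq)
    Cond6 = ∀ f → f ∈Q → ¬ (f ≈ₚ 0ₚ) → ∀ β → β ∈supp f → IsDeg f ∣ β ∣ₑ →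
            ∃[ ξ ] (θ ξ ≤ₑ β)

-- The core is a division algorithm: every h can be written h = Σ p(λ) g(λ) + h′ with no support
-- element of h′ in ∇({θ(λ)}) and supp p(λ) + θ(λ) ⊆ Δ(supp h). It repeatedly cancels a reducible
-- support element β = δ + θ(λ) of top total degree by subtracting its coefficient times x^δ g(λ);
-- as g(λ) is monic, this only adds support elements below β of smaller degree.
-- Under (2) the remainder of f ∈ Q lies in Q and so vanishes, which gives (3), and (5) by taking
-- degrees. Conversely, a maximal (resp. top-degree) β ∈ supp f = supp Σ p(λ) g(λ) is some α + γ with
-- γ ∈ supp g(λ), and the bound in (3) (resp. (5)) forces γ = θ(λ), whence θ(λ) ≤ β. A support element
-- of top total degree is maximal, so (4) and (6) give (1), which is (2) restated classically.

module Submission where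

open import Defs
open import Level using (Level; _⊔_; Lift; lift; lower)
open import Algebra.Bundles using (CommutativeRing)
open import Axiom.ExcludedMiddle using (ExcludedMiddle)
open import Axiom.DoubleNegationElimination using (em⇒dne)
open import Data.Nat using (ℕ; zero; suc; _≤_; _<_; s≤s; s≤s⁻¹; z≤n)
import Data.Nat.Properties as ℕ
open import Data.Fin using (Fin) renaming (zero to fzero; suc to fsuc)
import Data.Fin.Properties as Fin
open import Data.Vec using ([]; _∷_; sum; replicate)
open import Data.Vec.Properties using (≡-dec; ∷-injective; zipWith-identityˡ)
open import Data.Vec.Functional using (updateAt)
open import Data.Vec.Functional.Properties using (updateAt-updates; updateAt-minimal)
open import Data.List using (List; []; _∷_; _++_; map; filter)
open import Data.List.Membership.Propositional using (_∈_)
open import Data.List.Membership.Propositional.Properties using (∈-map⁺; ∈-filter⁺)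
open import Data.List.Relation.Unary.All as All using (All; []; _∷_)
open import Data.List.Relation.Unary.All.Properties using (all-filter)
open import Data.List.Relation.Unary.Any using (here; there)
import Data.List.Relation.Unary.Any as Any
open import Data.List.Extrema.Nat using (argmax; argmax-all; f[xs]≤f[argmax]; max; xs≤max)
open import Data.Product using (∃-syntax; _×_; _,_; proj₁; proj₂)
open import Data.Sum using (_⊎_; inj₁; inj₂)
open import Data.Empty using (⊥-elim)
open import Function using (_∘_; case_of_)
open import Function.Bundles using (_⇔_; mk⇔)
open import Relation.Nullary using (¬_; Dec; yes; no)
open import Relation.Nullary.Decidable using (map′)
open import Relation.Binary.PropositionalEquality as P using (_≡_; _≢_; cong; cong₂; subst; subst₂)
open import Algebra.Properties.CommutativeSemigroup ℕ.+-commutativeSemigroup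
  using () renaming (interchange to ℕ-interchange)

em-lower : ∀ {a b} → ExcludedMiddle (a ⊔ b) → ExcludedMiddle a
em-lower {b = b} em = map′ lower lift (em {Lift b _})

module Exponents where

  open import Data.Nat using (_+_; _∸_)

  private
    variable
      n : ℕ
      a b : ℕ
      α β γ : Exp n

  ≤ₑ-refl : α ≤ₑ α
  ≤ₑ-refl _ = ℕ.≤-refl

  ≤ₑ-trans : α ≤ₑ β → β ≤ₑ γ → α ≤ₑ γ
  ≤ₑ-trans α≤β β≤γ i = ℕ.≤-trans (α≤β i) (β≤γ i)

  ≤ₑ-cons : a ≤ b → α ≤ₑ β → (a ∷ α) ≤ₑ (b ∷ β)
  ≤ₑ-cons a≤b α≤β fzero = a≤b
  ≤ₑ-cons a≤b α≤β (fsuc i) = α≤β i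

  m≤ₑn+ₑm : (α β : Exp n) → β ≤ₑ (α +ₑ β)
  m≤ₑn+ₑm (a ∷ α) (b ∷ β) = ≤ₑ-cons (ℕ.m≤n+m b a) (m≤ₑn+ₑm α β)
  m≤ₑn+ₑm [] [] ()

  +ₑ-monoʳ-≤ₑ : (α : Exp n) → β ≤ₑ γ → (α +ₑ β) ≤ₑ (α +ₑ γ)
  +ₑ-monoʳ-≤ₑ {β = []} {[]} [] _ ()
  +ₑ-monoʳ-≤ₑ {β = _ ∷ _} {_ ∷ _} (a ∷ α) β≤γ =
    ≤ₑ-cons (ℕ.+-monoʳ-≤ a (β≤γ fzero)) (+ₑ-monoʳ-≤ₑ α (β≤γ ∘ fsuc))

  +ₑ-cancelˡ-≡ : (α : Exp n) → α +ₑ β ≡ α +ₑ γ → β ≡ γ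
  +ₑ-cancelˡ-≡ {β = []} {[]} [] _ = P.refl
  +ₑ-cancelˡ-≡ {β = _ ∷ _} {_ ∷ _} (a ∷ α) eq with ∷-injective eq
  ... | head≡ , tail≡ = cong₂ _∷_ (ℕ.+-cancelˡ-≡ a _ _ head≡) (+ₑ-cancelˡ-≡ α tail≡)

  ∣∣ₑ-homo-+ₑ : (α β : Exp n) → ∣ α +ₑ β ∣ₑ ≡ ∣ α ∣ₑ + ∣ β ∣ₑ
  ∣∣ₑ-homo-+ₑ [] [] = P.refl
  ∣∣ₑ-homo-+ₑ (a ∷ α) (b ∷ β) =
    P.trans (cong (a + b +_) (∣∣ₑ-homo-+ₑ α β)) (ℕ-interchange a b (sum α) (sum β))

  ∣∣ₑ-mono-≤ₑ : α ≤ₑ β → ∣ α ∣ₑ ≤ ∣ β ∣ₑ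
  ∣∣ₑ-mono-≤ₑ {α = []} {[]} _ = z≤n
  ∣∣ₑ-mono-≤ₑ {α = _ ∷ α} {_ ∷ β} α≤β =
    ℕ.+-mono-≤ (α≤β fzero) (∣∣ₑ-mono-≤ₑ {α = α} {β} (α≤β ∘ fsuc))

  ≤ₑ-∣∣ₑ-antisym : α ≤ₑ β → ∣ β ∣ₑ ≤ ∣ α ∣ₑ → α ≡ β
  ≤ₑ-∣∣ₑ-antisym {α = []} {[]} _ _ = P.refl
  ≤ₑ-∣∣ₑ-antisym {α = a ∷ α} {b ∷ β} α≤β ∣β∣≤∣α∣ =
    cong₂ _∷_ a≡b (≤ₑ-∣∣ₑ-antisym {α = α} {β} (α≤β ∘ fsuc) ∑β≤∑α)
    where
    ∑α≤∑β : sum α ≤ sum β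
    ∑α≤∑β = ∣∣ₑ-mono-≤ₑ {α = α} {β} (α≤β ∘ fsuc)
    a≡b : a ≡ b
    a≡b = ℕ.≤-antisym (α≤β fzero) (ℕ.+-cancelʳ-≤ (sum β) b a (ℕ.≤-trans ∣β∣≤∣α∣ (ℕ.+-monoʳ-≤ a ∑α≤∑β)))
    ∑β≤∑α : sum β ≤ sum α
    ∑β≤∑α = ℕ.+-cancelˡ-≤ a (sum β) (sum α) (subst (λ x → x + sum β ≤ a + sum α) (P.sym a≡b) ∣β∣≤∣α∣)

  ≤ₑ∧≢⇒∣∣ₑ< : α ≤ₑ β → α ≢ β → ∣ α ∣ₑ < ∣ β ∣ₑ
  ≤ₑ∧≢⇒∣∣ₑ< {α = α} {β} α≤β α≢β = ℕ.≤∧≢⇒< (∣∣ₑ-mono-≤ₑ {α = α} {β} α≤β) λ ∣α∣≡∣β∣ →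
    α≢β (≤ₑ-∣∣ₑ-antisym {α = α} {β} α≤β (ℕ.≤-reflexive (P.sym ∣α∣≡∣β∣)))

  ≤ₑ⇒∃+ₑ : α ≤ₑ β → ∃[ δ ] β ≡ δ +ₑ α
  ≤ₑ⇒∃+ₑ {α = []} {[]} _ = [] , P.refl
  ≤ₑ⇒∃+ₑ {α = a ∷ α} {b ∷ β} α≤β with ≤ₑ⇒∃+ₑ {α = α} {β} (α≤β ∘ fsuc)
  ... | δ , β≡δ+α = (b ∸ a) ∷ δ , cong₂ _∷_ (P.sym (ℕ.m∸n+n≡m (α≤β fzero))) β≡δ+α

open Exponents

module Polynomials {c ℓ : Level} (R : CommutativeRing c ℓ) (n : ℕ) where

  open CommutativeRing R
  open Poly R n
  open import Relation.Binary.Reasoning.Setoid setoid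
  open import Algebra.Properties.Ring ring using (-‿distribˡ-*; -1*x≈-x)
  open import Algebra.Properties.AbelianGroup +-abelianGroup using (xyx⁻¹≈y)
  open import Algebra.Properties.Group +-group using (//-rightDividesˡ)
  open import Algebra.Properties.CommutativeSemigroup +-commutativeSemigroup using (xy∙z≈xz∙y; x∙yz≈y∙xz)

  _≟ₑ_ : (α β : Exp n) → Dec (α ≡ β)
  _≟ₑ_ = ≡-dec Data.Nat._≟_

  keys : Ω → List (Exp n)
  keys = map proj₁

  infix 30 x^_·_
  x^_·_ : Exp n → Carrier → Ω
  x^ δ · k = (δ , k) ∷ []

  ∈supp-resp : ∀ {f g α} → f ≈ₚ g → α ∈supp f → α ∈supp g
  ∈supp-resp f≈g α∈f g≈0 = α∈f (trans (f≈g _) g≈0)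

  ∈supp⇒∈keys : ∀ {f α} → α ∈supp f → α ∈ keys f
  ∈supp⇒∈keys {[]} α∈f = ⊥-elim (α∈f refl)
  ∈supp⇒∈keys {(β , _) ∷ f} {α} α∈f with β ≟ₑ α
  ... | yes β≡α = here (P.sym β≡α)
  ... | no _ = there (∈supp⇒∈keys {f} α∈f)

  ∈supp-monomial : ∀ {δ k α} → α ∈supp (x^ δ · k) → δ ≡ α
  ∈supp-monomial {δ} {k} {α} α∈ with δ ≟ₑ α
  ... | yes δ≡α = δ≡α
  ... | no _ = ⊥-elim (α∈ refl)

  supp-degree-bound : ∀ f → ∃[ d ] (∀ α → α ∈supp f → ∣ α ∣ₑ < d)
  supp-degree-bound f =
    suc (max 0 (map ∣_∣ₑ (keys f))) ,
    λ α α∈f → s≤s (All.lookup (xs≤max 0 (map ∣_∣ₑ (keys f))) (∈-map⁺ ∣_∣ₑ (∈supp⇒∈keys {f} α∈f)))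

  maxDegree⇒∈maxsupp : ∀ {f β} → β ∈supp f → (∀ γ → γ ∈supp f → ∣ γ ∣ₑ ≤ ∣ β ∣ₑ) → β ∈maxsupp f
  maxDegree⇒∈maxsupp {β = β} β∈f top = β∈f , λ α α∈f β≤α → ≤ₑ-∣∣ₑ-antisym {α = β} {α} β≤α (top α α∈f)

  coeff-++ : ∀ f g α → coeff (f +ₚ g) α ≈ coeff f α + coeff g α
  coeff-++ [] g α = sym (+-identityˡ _)
  coeff-++ ((β , a) ∷ f) g α with β ≟ₑ α
  ... | yes _ = trans (+-congˡ (coeff-++ f g α)) (sym (+-assoc _ _ _))
  ... | no _ = coeff-++ f g α

  coeff-*ₚ-∷ : ∀ δ k p f α → coeff (((δ , k) ∷ p) *ₚ f) α ≈ coeff (x^ δ · k *ₚ f) α + coeff (p *ₚ f) α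
  coeff-*ₚ-∷ δ k p f α = begin
    coeff (((δ , k) ∷ p) *ₚ f) α              ≈⟨ coeff-++ shifted (p *ₚ f) α ⟩
    coeff shifted α + coeff (p *ₚ f) α          ≈⟨ +-congʳ (sym (trans (coeff-++ shifted [] α) (+-identityʳ _))) ⟩
    coeff (x^ δ · k *ₚ f) α + coeff (p *ₚ f) α  ∎
    where
    -- x^ δ · k *ₚ f unfolds to shifted ++ []
    shifted : Ω
    shifted = map (λ t → δ +ₑ proj₁ t , k * proj₂ t) f

  coeff-*ₚ-++ : ∀ p q f α → coeff ((p ++ q) *ₚ f) α ≈ coeff (p *ₚ f) α + coeff (q *ₚ f) α
  coeff-*ₚ-++ [] q f α = sym (+-identityˡ _)
  coeff-*ₚ-++ ((δ , k) ∷ p) q f α = begin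
    coeff (((δ , k) ∷ p ++ q) *ₚ f) α          ≈⟨ coeff-*ₚ-∷ δ k (p ++ q) f α ⟩
    coeff δkf α + coeff ((p ++ q) *ₚ f) α       ≈⟨ +-congˡ (coeff-*ₚ-++ p q f α) ⟩
    coeff δkf α + (coeff pf α + coeff qf α)     ≈⟨ sym (+-assoc _ _ _) ⟩
    coeff δkf α + coeff pf α + coeff qf α       ≈⟨ +-congʳ (sym (coeff-*ₚ-∷ δ k p f α)) ⟩
    coeff (((δ , k) ∷ p) *ₚ f) α + coeff qf α   ∎
    where
    δkf pf qf : Ω
    δkf = x^ δ · k *ₚ f
    pf = p *ₚ f
    qf = q *ₚ f

  coeff-monomial-*ₚ : ∀ δ k f γ → coeff (x^ δ · k *ₚ f) (δ +ₑ γ) ≈ k * coeff f γ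
  coeff-monomial-*ₚ δ k [] γ = sym (zeroʳ k)
  coeff-monomial-*ₚ δ k ((β , b) ∷ f) γ with (δ +ₑ β) ≟ₑ (δ +ₑ γ) | β ≟ₑ γ
  ... | yes _ | yes _ = trans (+-congˡ (coeff-monomial-*ₚ δ k f γ)) (sym (distribˡ k b _))
  ... | yes δ+β≡δ+γ | no β≢γ = ⊥-elim (β≢γ (+ₑ-cancelˡ-≡ δ δ+β≡δ+γ))
  ... | no δ+β≢δ+γ | yes P.refl = ⊥-elim (δ+β≢δ+γ P.refl)
  ... | no _ | no _ = coeff-monomial-*ₚ δ k f γ

  coeff-monomial-*ₚ-∉ : ∀ δ k f α → (∀ γ → α ≢ δ +ₑ γ) → coeff (x^ δ · k *ₚ f) α ≈ 0#
  coeff-monomial-*ₚ-∉ δ k [] α _ = refl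
  coeff-monomial-*ₚ-∉ δ k ((β , b) ∷ f) α α∉ with (δ +ₑ β) ≟ₑ α
  ... | yes δ+β≡α = ⊥-elim (α∉ β (P.sym δ+β≡α))
  ... | no _ = coeff-monomial-*ₚ-∉ δ k f α α∉

  coeff-monomial-*ₚ-scale : ∀ δ k f α → coeff (x^ δ · k *ₚ f) α ≈ k * coeff (x^ δ · 1# *ₚ f) α
  coeff-monomial-*ₚ-scale δ k [] α = sym (zeroʳ k)
  coeff-monomial-*ₚ-scale δ k ((β , b) ∷ f) α with (δ +ₑ β) ≟ₑ α
  ... | yes _ = trans (+-cong (*-congˡ (sym (*-identityˡ b))) (coeff-monomial-*ₚ-scale δ k f α))
                      (sym (distribˡ k _ _))
  ... | no _ = coeff-monomial-*ₚ-scale δ k f α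

  coeff-monomial-neg-*ₚ : ∀ δ k f α → coeff (x^ δ · (- k) *ₚ f) α ≈ - coeff (x^ δ · k *ₚ f) α
  coeff-monomial-neg-*ₚ δ k f α = begin
    coeff (x^ δ · (- k) *ₚ f) α         ≈⟨ coeff-monomial-*ₚ-scale δ (- k) f α ⟩
    - k * coeff (x^ δ · 1# *ₚ f) α      ≈⟨ sym (-‿distribˡ-* k _) ⟩
    - (k * coeff (x^ δ · 1# *ₚ f) α)    ≈⟨ -‿cong (sym (coeff-monomial-*ₚ-scale δ k f α)) ⟩
    - coeff (x^ δ · k *ₚ f) α           ∎

  remove : Exp n → Ω → Ω
  remove κ [] = []
  remove κ ((δ , k) ∷ p) with δ ≟ₑ κ
  ... | yes _ = remove κ p
  ... | no _ = (δ , k) ∷ remove κ p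

  coeff-remove-≡ : ∀ κ p → coeff (remove κ p) κ ≈ 0#
  coeff-remove-≡ κ [] = refl
  coeff-remove-≡ κ ((δ , k) ∷ p) with δ ≟ₑ κ
  ... | yes _ = coeff-remove-≡ κ p
  ... | no δ≢κ with δ ≟ₑ κ
  ...   | yes δ≡κ = ⊥-elim (δ≢κ δ≡κ)
  ...   | no _ = coeff-remove-≡ κ p

  coeff-remove-≢ : ∀ κ p α → α ≢ κ → coeff (remove κ p) α ≈ coeff p α
  coeff-remove-≢ κ [] α _ = refl
  coeff-remove-≢ κ ((δ , k) ∷ p) α α≢κ with δ ≟ₑ κ
  ... | yes P.refl with δ ≟ₑ α
  ...   | yes P.refl = ⊥-elim (α≢κ P.refl)
  ...   | no _ = coeff-remove-≢ κ p α α≢κ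
  coeff-remove-≢ κ ((δ , k) ∷ p) α α≢κ | no _ with δ ≟ₑ α
  ...   | yes _ = +-congˡ (coeff-remove-≢ κ p α α≢κ)
  ...   | no _ = coeff-remove-≢ κ p α α≢κ

  keys-remove : ∀ κ K p → All (_∈ κ ∷ K) (keys p) → All (_∈ K) (keys (remove κ p))
  keys-remove κ K [] [] = []
  keys-remove κ K ((δ , k) ∷ p) (δ∈ ∷ ∈K) with δ ≟ₑ κ
  ... | yes _ = keys-remove κ K p ∈K
  ... | no δ≢κ = Any.tail δ≢κ δ∈ ∷ keys-remove κ K p ∈K

  module _ (G : Exp n → Carrier) where

    pairing : Ω → Carrier
    pairing [] = 0#
    pairing ((δ , k) ∷ p) = k * G δ + pairing p

    pairing-remove : ∀ κ p → pairing p ≈ coeff p κ * G κ + pairing (remove κ p)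
    pairing-remove κ [] = sym (trans (+-congʳ (zeroˡ _)) (+-identityʳ _))
    pairing-remove κ ((δ , k) ∷ p) with δ ≟ₑ κ
    ... | yes P.refl = begin
      k * G δ + pairing p                                   ≈⟨ +-congˡ (pairing-remove δ p) ⟩
      k * G δ + (coeff p δ * G δ + pairing (remove δ p))    ≈⟨ sym (+-assoc _ _ _) ⟩
      k * G δ + coeff p δ * G δ + pairing (remove δ p)      ≈⟨ +-congʳ (sym (distribʳ _ _ _)) ⟩
      (k + coeff p δ) * G δ + pairing (remove δ p)          ∎
    ... | no _ = begin
      k * G δ + pairing p                                   ≈⟨ +-congˡ (pairing-remove κ p) ⟩
      k * G δ + (coeff p κ * G κ + pairing (remove κ p))    ≈⟨ x∙yz≈y∙xz _ _ _ ⟩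
      coeff p κ * G κ + (k * G δ + pairing (remove κ p))    ∎

  coeff-*ₚ-pairing : ∀ p f α → coeff (p *ₚ f) α ≈ pairing (λ δ → coeff (x^ δ · 1# *ₚ f) α) p
  coeff-*ₚ-pairing [] f α = refl
  coeff-*ₚ-pairing ((δ , k) ∷ p) f α =
    trans (coeff-*ₚ-∷ δ k p f α) (+-cong (coeff-monomial-*ₚ-scale δ k f α) (coeff-*ₚ-pairing p f α))

  lincomb : ∀ {m} → (Fin m → Ω) → (Fin m → Ω) → Ω
  lincomb p g = Σₚ (λ r → p r *ₚ g r)

  coeff-lincomb-0 : ∀ {m} (g : Fin m → Ω) α → coeff (lincomb (λ _ → []) g) α ≈ 0#
  coeff-lincomb-0 {zero} g α = refl
  coeff-lincomb-0 {suc m} g α = coeff-lincomb-0 (g ∘ fsuc) α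

  coeff-lincomb-updateAt : ∀ {m} (p g : Fin m → Ω) r₀ x α →
    coeff (lincomb (updateAt p r₀ (_++ x)) g) α ≈ coeff (lincomb p g) α + coeff (x *ₚ g r₀) α
  coeff-lincomb-updateAt p g fzero x α = begin
    coeff ((p₀ ++ x) *ₚ g₀ ++ rest) α                     ≈⟨ coeff-++ ((p₀ ++ x) *ₚ g₀) rest α ⟩
    coeff ((p₀ ++ x) *ₚ g₀) α + coeff rest α              ≈⟨ +-congʳ (coeff-*ₚ-++ p₀ x g₀ α) ⟩
    coeff (p₀ *ₚ g₀) α + coeff (x *ₚ g₀) α + coeff rest α ≈⟨ xy∙z≈xz∙y _ _ _ ⟩
    coeff (p₀ *ₚ g₀) α + coeff rest α + coeff (x *ₚ g₀) α ≈⟨ +-congʳ (sym (coeff-++ (p₀ *ₚ g₀) rest α)) ⟩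
    coeff (lincomb p g) α + coeff (x *ₚ g₀) α             ∎
    where
    p₀ g₀ rest : Ω
    p₀ = p fzero
    g₀ = g fzero
    rest = lincomb (p ∘ fsuc) (g ∘ fsuc)
  coeff-lincomb-updateAt p g (fsuc r₀) x α = begin
    coeff (head ++ rest′) α          ≈⟨ coeff-++ head rest′ α ⟩
    coeff head α + coeff rest′ α     ≈⟨ +-congˡ (coeff-lincomb-updateAt (p ∘ fsuc) (g ∘ fsuc) r₀ x α) ⟩
    coeff head α + (coeff rest α + y) ≈⟨ sym (+-assoc _ _ _) ⟩
    coeff head α + coeff rest α + y  ≈⟨ +-congʳ (sym (coeff-++ head rest α)) ⟩
    coeff (lincomb p g) α + y        ∎
    where
    head rest rest′ : Ω
    head = p fzero *ₚ g fzero
    rest = lincomb (p ∘ fsuc) (g ∘ fsuc)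
    rest′ = lincomb (updateAt (p ∘ fsuc) r₀ (_++ x)) (g ∘ fsuc)
    y : Carrier
    y = coeff (x *ₚ g (fsuc r₀)) α

  -ₚ_ : Ω → Ω
  -ₚ f = x^ replicate n 0 · (- 1#) *ₚ f

  coeff-neg : ∀ f α → coeff (-ₚ f) α ≈ - coeff f α
  coeff-neg f α = begin
    coeff (-ₚ f) α                            ≈⟨ reflexive (cong (coeff (-ₚ f)) (P.sym 0+ₑα≡α)) ⟩
    coeff (-ₚ f) (replicate n 0 +ₑ α)         ≈⟨ coeff-monomial-*ₚ (replicate n 0) (- 1#) f α ⟩
    - 1# * coeff f α                          ≈⟨ -1*x≈-x _ ⟩
    - coeff f α                               ∎
    where
    0+ₑα≡α : replicate n 0 +ₑ α ≡ α
    0+ₑα≡α = zipWith-identityˡ ℕ.+-identityˡ α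

  module _ {ℓq : Level} (Q : Ideal ℓq) where

    open Ideal Q

    Σₚ-closed : ∀ {m} (A : Fin m → Ω) → (∀ r → A r ∈Q) → Σₚ A ∈Q
    Σₚ-closed {zero} A _ = 0∈Q
    Σₚ-closed {suc m} A A∈Q = +-closed (A∈Q fzero) (Σₚ-closed (A ∘ fsuc) (A∈Q ∘ fsuc))

    ∈Q-cancelˡ : ∀ {f g h} → f ∈Q → g ∈Q → f ≈ₚ (g +ₚ h) → h ∈Q
    ∈Q-cancelˡ {f} {g} {h} f∈Q g∈Q f≈g+h =
      resp f-g≈h (+-closed f∈Q (*-closed (x^ replicate n 0 · (- 1#)) g∈Q))
      where
      f-g≈h : (f +ₚ (-ₚ g)) ≈ₚ h
      f-g≈h α = begin
        coeff (f +ₚ (-ₚ g)) α                  ≈⟨ coeff-++ f (-ₚ g) α ⟩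
        coeff f α + coeff (-ₚ g) α             ≈⟨ +-cong (f≈g+h α) (coeff-neg g α) ⟩
        coeff (g +ₚ h) α + - coeff g α         ≈⟨ +-congʳ (coeff-++ g h α) ⟩
        coeff g α + coeff h α + - coeff g α    ≈⟨ xyx⁻¹≈y _ _ ⟩
        coeff h α                              ∎

  module Classical (em : ExcludedMiddle ℓ) where

    private
      em₀ : ExcludedMiddle Level.zero
      em₀ = em-lower em

    dne : ∀ {A : Set ℓ} → ¬ ¬ A → A
    dne = em⇒dne em

    ∃-∈supp : ∀ {f} → ¬ (f ≈ₚ 0ₚ) → ∃[ α ] α ∈supp f
    ∃-∈supp {f} f≉0 = dne λ ∄ → f≉0 λ α → dne λ (α∈f : α ∈supp f) → ∄ (α , α∈f)

    ∃-maxDegree : ∀ {f} → ¬ (f ≈ₚ 0ₚ) → ∃[ β ] (β ∈supp f × (∀ γ → γ ∈supp f → ∣ γ ∣ₑ ≤ ∣ β ∣ₑ))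
    ∃-maxDegree {f} f≉0 with ∃-∈supp {f} f≉0
    ... | α , α∈f = β , argmax-all ∣_∣ₑ {P = _∈supp f} α∈f (all-filter ∈supp? (keys f)) , top
      where
      ∈supp? : ∀ α → Dec (α ∈supp f)
      ∈supp? _ = em
      candidates : List (Exp n)
      candidates = filter ∈supp? (keys f)
      β : Exp n
      β = argmax ∣_∣ₑ α candidates
      top : ∀ γ → γ ∈supp f → ∣ γ ∣ₑ ≤ ∣ β ∣ₑ
      top γ γ∈f = All.lookup (f[xs]≤f[argmax] α candidates) (∈-filter⁺ ∈supp? (∈supp⇒∈keys {f} γ∈f) γ∈f)

    ∈supp-++ : ∀ {f g α} → α ∈supp (f +ₚ g) → α ∈supp f ⊎ α ∈supp g
    ∈supp-++ {f} {g} {α} α∈ with em {coeff f α ≈ 0#}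
    ... | no α∈f = inj₁ α∈f
    ... | yes f≈0 = inj₂ λ g≈0 → α∈ (trans (coeff-++ f g α) (trans (+-cong f≈0 g≈0) (+-identityʳ 0#)))

    ∈supp-Σₚ : ∀ {m} (A : Fin m → Ω) {α} → α ∈supp Σₚ A → ∃[ r ] α ∈supp A r
    ∈supp-Σₚ {zero} A α∈ = ⊥-elim (α∈ refl)
    ∈supp-Σₚ {suc m} A α∈ with ∈supp-++ {A fzero} α∈
    ... | inj₁ α∈A₀ = fzero , α∈A₀
    ... | inj₂ α∈rest with ∈supp-Σₚ (A ∘ fsuc) α∈rest
    ...   | r , α∈Ar = fsuc r , α∈Ar

    ∈supp-updateAt : ∀ {m} (p : Fin m → Ω) r₀ x r {α} →
      α ∈supp updateAt p r₀ (_++ x) r → α ∈supp p r ⊎ (r ≡ r₀ × α ∈supp x)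
    ∈supp-updateAt p r₀ x r {α} α∈ with r Fin.≟ r₀
    ... | no r≢r₀ = inj₁ (subst (α ∈supp_) (updateAt-minimal r r₀ p r≢r₀) α∈)
    ... | yes P.refl with ∈supp-++ {p r} (subst (α ∈supp_) (updateAt-updates r p) α∈)
    ...   | inj₁ α∈p = inj₁ α∈p
    ...   | inj₂ α∈x = inj₂ (P.refl , α∈x)

    -- Grouping the terms of p by exponent: the pairing only sees the coefficients of p.
    pairing-vanishes : ∀ G p → (∀ δ → δ ∈supp p → G δ ≈ 0#) → pairing G p ≈ 0#
    pairing-vanishes G p = go (keys p) p (All.tabulate λ δ∈ → δ∈)
      where
      go : ∀ K p → All (_∈ K) (keys p) → (∀ δ → δ ∈supp p → G δ ≈ 0#) → pairing G p ≈ 0#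
      go [] [] _ _ = refl
      go [] (_ ∷ _) (() ∷ _) _
      go (κ ∷ K) p keys∈ G≈0 = begin
        pairing G p                                ≈⟨ pairing-remove G κ p ⟩
        coeff p κ * G κ + pairing G (remove κ p)   ≈⟨ +-cong term≈0 rest≈0 ⟩
        0# + 0#                                    ≈⟨ +-identityʳ 0# ⟩
        0#                                         ∎
        where
        term≈0 : coeff p κ * G κ ≈ 0#
        term≈0 with em {coeff p κ ≈ 0#}
        ... | yes p≈0 = trans (*-congʳ p≈0) (zeroˡ _)
        ... | no κ∈p = trans (*-congˡ (G≈0 κ κ∈p)) (zeroʳ _)
        G≈0′ : ∀ δ → δ ∈supp remove κ p → G δ ≈ 0#
        G≈0′ δ δ∈ with δ ≟ₑ κ
        ... | yes P.refl = ⊥-elim (δ∈ (coeff-remove-≡ δ p))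
        ... | no δ≢κ = G≈0 δ λ p≈0 → δ∈ (trans (coeff-remove-≢ κ p δ δ≢κ) p≈0)
        rest≈0 : pairing G (remove κ p) ≈ 0#
        rest≈0 = go K (remove κ p) (keys-remove κ K p keys∈) G≈0′

    ∈supp-monomial-*ₚ : ∀ {δ k f α} → α ∈supp (x^ δ · k *ₚ f) → ∃[ γ ] (γ ∈supp f × α ≡ δ +ₑ γ)
    ∈supp-monomial-*ₚ {δ} {k} {f} {α} α∈ with em₀ {∃[ γ ] α ≡ δ +ₑ γ}
    ... | yes (γ , P.refl) =
      γ , (λ f≈0 → α∈ (trans (coeff-monomial-*ₚ δ k f γ) (trans (*-congˡ f≈0) (zeroʳ k)))) , P.refl
    ... | no ∄ = ⊥-elim (α∈ (coeff-monomial-*ₚ-∉ δ k f α λ γ α≡δ+γ → ∄ (γ , α≡δ+γ)))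

    ∈supp-*ₚ : ∀ {p f α} → α ∈supp (p *ₚ f) → ∃[ δ ] ∃[ γ ] (δ ∈supp p × γ ∈supp f × δ +ₑ γ ≡ α)
    ∈supp-*ₚ {p} {f} {α} α∈ = dne λ ∄ →
      α∈ (trans (coeff-*ₚ-pairing p f α) (pairing-vanishes _ p λ δ δ∈p → dne λ α∈δf →
        let γ , γ∈f , α≡δ+γ = ∈supp-monomial-*ₚ {δ} {1#} {f} α∈δf
        in  ∄ (δ , γ , δ∈p , γ∈f , P.sym α≡δ+γ)))

    ∈supp-lincomb : ∀ {m} (p g : Fin m → Ω) {α} → α ∈supp lincomb p g →
      ∃[ r ] ∃[ δ ] ∃[ γ ] (δ ∈supp p r × γ ∈supp g r × δ +ₑ γ ≡ α)
    ∈supp-lincomb p g α∈ with ∈supp-Σₚ (λ r → p r *ₚ g r) α∈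
    ... | r , α∈pg = r , ∈supp-*ₚ {p r} α∈pg

  module DivisionAlgorithm (em : ExcludedMiddle ℓ) {m : ℕ} (g : Fin m → Ω) (θ : Fin m → Exp n)
                           (monic : ∀ r → MonicWith (g r) (θ r)) where

    open Classical em

    θ-∈supp : ∀ r → θ r ∈supp g r
    θ-∈supp r = proj₁ (monic r)

    coeff-θ≈1 : ∀ r → coeff (g r) (θ r) ≈ 1#
    coeff-θ≈1 r = proj₁ (proj₂ (monic r))

    supp≤θ : ∀ r γ → γ ∈supp g r → γ ≤ₑ θ r
    supp≤θ r = proj₂ (proj₂ (monic r))

    Reducible : Exp n → Set
    Reducible α = ∃[ r ] θ r ≤ₑ α

    record Division (h : Ω) : Set (c ⊔ ℓ) where
      field
        quotient              : Fin m → Ω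
        remainder             : Ω
        decomposition         : h ≈ₚ (lincomb quotient g +ₚ remainder)
        remainder-irreducible : ∀ α → α ∈supp remainder → ¬ Reducible α
        quotient-bounded      : ∀ r α → α ∈supp quotient r → ∃[ β ] (β ∈supp h × (α +ₑ θ r) ≤ₑ β)

    irreducible-division : ∀ {h} → (∀ α → α ∈supp h → ¬ Reducible α) → Division h
    irreducible-division {h} irreducible = record
      { quotient              = λ _ → []
      ; remainder             = h
      ; decomposition         = λ α → sym (trans (coeff-++ (lincomb (λ _ → []) g) h α)
                                                 (trans (+-congʳ (coeff-lincomb-0 g α)) (+-identityˡ _)))
      ; remainder-irreducible = irreducible
      ; quotient-bounded      = λ _ _ α∈[] → ⊥-elim (α∈[] refl)
      }

    module Reduction (h : Ω) (r₀ : Fin m) (δ : Exp n) where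

      β : Exp n
      β = δ +ₑ θ r₀

      c₀ : Carrier
      c₀ = coeff h β

      reduct : Ω
      reduct = h +ₚ (x^ δ · (- c₀) *ₚ g r₀)

      coeff-reduct-β : coeff reduct β ≈ 0#
      coeff-reduct-β = begin
        coeff reduct β                          ≈⟨ coeff-++ h (x^ δ · (- c₀) *ₚ g r₀) β ⟩
        c₀ + coeff (x^ δ · (- c₀) *ₚ g r₀) β    ≈⟨ +-congˡ (coeff-monomial-*ₚ δ (- c₀) (g r₀) (θ r₀)) ⟩
        c₀ + - c₀ * coeff (g r₀) (θ r₀)         ≈⟨ +-congˡ (*-congˡ (coeff-θ≈1 r₀)) ⟩
        c₀ + - c₀ * 1#                          ≈⟨ +-congˡ (*-identityʳ _) ⟩
        c₀ + - c₀                               ≈⟨ -‿inverseʳ c₀ ⟩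
        0#                                      ∎

      supp-reduct : ∀ α → α ∈supp reduct → α ∈supp h ⊎ (α ≤ₑ β × ∣ α ∣ₑ < ∣ β ∣ₑ)
      supp-reduct α α∈ with ∈supp-++ {h} α∈
      ... | inj₁ α∈h = inj₁ α∈h
      ... | inj₂ α∈δg with ∈supp-monomial-*ₚ {δ} {_} {g r₀} α∈δg
      ...   | γ , γ∈g , P.refl = inj₂ (+ₑ-monoʳ-≤ₑ δ γ≤θ , degree<)
        where
        γ≤θ : γ ≤ₑ θ r₀
        γ≤θ = supp≤θ r₀ γ γ∈g
        γ≢θ : γ ≢ θ r₀
        γ≢θ P.refl = α∈ coeff-reduct-β
        degree< : ∣ δ +ₑ γ ∣ₑ < ∣ β ∣ₑ
        degree< = subst₂ _<_ (P.sym (∣∣ₑ-homo-+ₑ δ γ)) (P.sym (∣∣ₑ-homo-+ₑ δ (θ r₀)))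
                             (ℕ.+-monoʳ-< ∣ δ ∣ₑ (≤ₑ∧≢⇒∣∣ₑ< {α = γ} {θ r₀} γ≤θ γ≢θ))

      coeff-h : ∀ α → coeff h α ≈ coeff reduct α + coeff (x^ δ · c₀ *ₚ g r₀) α
      coeff-h α = begin
        coeff h α
          ≈⟨ sym (//-rightDividesˡ y (coeff h α)) ⟩
        coeff h α + - y + y
          ≈⟨ +-congʳ (+-congˡ (sym (coeff-monomial-neg-*ₚ δ c₀ (g r₀) α))) ⟩
        coeff h α + coeff (x^ δ · (- c₀) *ₚ g r₀) α + y
          ≈⟨ +-congʳ (sym (coeff-++ h (x^ δ · (- c₀) *ₚ g r₀) α)) ⟩
        coeff reduct α + y
          ∎
        where
        y : Carrier
        y = coeff (x^ δ · c₀ *ₚ g r₀) α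

      division-from-reduct : β ∈supp h → Division reduct → Division h
      division-from-reduct β∈h D = record
        { quotient              = quotient′
        ; remainder             = remainder
        ; decomposition         = decomposition′
        ; remainder-irreducible = remainder-irreducible
        ; quotient-bounded      = bounded
        }
        where
        open Division D
        x : Ω
        x = x^ δ · c₀
        quotient′ : Fin m → Ω
        quotient′ = updateAt quotient r₀ (_++ x)
        decomposition′ : h ≈ₚ (lincomb quotient′ g +ₚ remainder)
        decomposition′ α = begin
          coeff h α                                ≈⟨ coeff-h α ⟩
          coeff reduct α + y                       ≈⟨ +-congʳ (decomposition α) ⟩
          coeff (Σpg +ₚ remainder) α + y           ≈⟨ +-congʳ (coeff-++ Σpg remainder α) ⟩
          coeff Σpg α + coeff remainder α + y      ≈⟨ xy∙z≈xz∙y _ _ _ ⟩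
          coeff Σpg α + y + coeff remainder α      ≈⟨ +-congʳ (sym (coeff-lincomb-updateAt quotient g r₀ x α)) ⟩
          coeff Σp′g α + coeff remainder α         ≈⟨ sym (coeff-++ Σp′g remainder α) ⟩
          coeff (Σp′g +ₚ remainder) α              ∎
          where
          Σpg Σp′g : Ω
          Σpg = lincomb quotient g
          Σp′g = lincomb quotient′ g
          y : Carrier
          y = coeff (x *ₚ g r₀) α
        bounded : ∀ r α → α ∈supp quotient′ r → ∃[ β′ ] (β′ ∈supp h × (α +ₑ θ r) ≤ₑ β′)
        bounded r α α∈ with ∈supp-updateAt quotient r₀ x r α∈
        ... | inj₂ (P.refl , α∈x) with ∈supp-monomial {δ} α∈x
        ...   | P.refl = β , β∈h , ≤ₑ-refl {α = β}
        bounded r α α∈ | inj₁ α∈q with quotient-bounded r α α∈q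
        ...   | β′ , β′∈ , α+θ≤β′ with supp-reduct β′ β′∈
        ...     | inj₁ β′∈h = β′ , β′∈h , α+θ≤β′
        ...     | inj₂ (β′≤β , _) = β , β∈h , ≤ₑ-trans {α = α +ₑ θ r} {β′} {β} α+θ≤β′ β′≤β

    ReducibleBelow : ℕ → Ω → Set ℓ
    ReducibleBelow d h = ∀ α → α ∈supp h → Reducible α → ∣ α ∣ₑ < d

    division-below-suc : ∀ d → (∀ h → ReducibleBelow d h → Division h) →
      ∀ K h → ReducibleBelow (suc d) h → (∀ α → α ∈supp h → Reducible α → ∣ α ∣ₑ ≡ d → α ∈ K) →
      Division h
    division-below-suc d divide [] h below top =
      divide h λ α α∈ red → ℕ.≤∧≢⇒< (s≤s⁻¹ (below α α∈ red)) λ ∣α∣≡d → case top α α∈ red ∣α∣≡d of λ ()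
    division-below-suc d divide (κ ∷ K) h below top with em {κ ∈supp h × Reducible κ}
    ... | no ¬κ-red = division-below-suc d divide K h below top′
      where
      top′ : ∀ α → α ∈supp h → Reducible α → ∣ α ∣ₑ ≡ d → α ∈ K
      top′ α α∈ red ∣α∣≡d with top α α∈ red ∣α∣≡d
      ... | here P.refl = ⊥-elim (¬κ-red (α∈ , red))
      ... | there α∈K = α∈K
    ... | yes (κ∈h , r₀ , θ≤κ) with ≤ₑ⇒∃+ₑ {α = θ r₀} {κ} θ≤κ
    ...   | δ , P.refl = division-from-reduct κ∈h (division-below-suc d divide K reduct below′ top′)
      where
      open Reduction h r₀ δ
      ∣β∣≤d : ∣ β ∣ₑ ≤ d
      ∣β∣≤d = s≤s⁻¹ (below β κ∈h (r₀ , θ≤κ))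
      below′ : ReducibleBelow (suc d) reduct
      below′ α α∈ red with supp-reduct α α∈
      ... | inj₁ α∈h = below α α∈h red
      ... | inj₂ (_ , ∣α∣<∣β∣) = ℕ.<-≤-trans ∣α∣<∣β∣ (ℕ.m≤n⇒m≤1+n ∣β∣≤d)
      top′ : ∀ α → α ∈supp reduct → Reducible α → ∣ α ∣ₑ ≡ d → α ∈ K
      top′ α α∈ red ∣α∣≡d with supp-reduct α α∈
      ... | inj₂ (_ , ∣α∣<∣β∣) = ⊥-elim (ℕ.<-irrefl ∣α∣≡d (ℕ.<-≤-trans ∣α∣<∣β∣ ∣β∣≤d))
      ... | inj₁ α∈h with top α α∈h red ∣α∣≡d
      ...   | here P.refl = ⊥-elim (α∈ coeff-reduct-β)
      ...   | there α∈K = α∈K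

    division-below : ∀ d h → ReducibleBelow d h → Division h
    division-below zero h below = irreducible-division λ α α∈ red → ℕ.n≮0 (below α α∈ red)
    division-below (suc d) h below =
      division-below-suc d (division-below d) (keys h) h below λ α α∈ _ _ → ∈supp⇒∈keys {h} α∈

    division : ∀ h → Division h
    division h with supp-degree-bound h
    ... | d , bound = division-below d h λ α α∈ _ → bound α α∈

  module Equivalences (em : ExcludedMiddle ℓ) {ℓq : Level} {m : ℕ} (g : Fin m → Ω) (θ : Fin m → Exp n)
                      (monic : ∀ r → MonicWith (g r) (θ r))
                      (Q : Ideal ℓq) (g∈Q : ∀ r → Ideal._∈Q Q (g r)) where

    open Classical em
    open DivisionAlgorithm em g θ monic
    open Ideal Q

    gb⇒cond2 : GroebnerBasis Q g θ → Cond2 Q g θ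
    gb⇒cond2 gb f f∈Q irreducible = dne λ f≉0 →
      let α , α∈f , red = gb f f∈Q f≉0 in irreducible α α∈f red

    cond2⇒gb : Cond2 Q g θ → GroebnerBasis Q g θ
    cond2⇒gb c2 τ τ∈Q τ≉0 = dne λ ∄ → τ≉0 (c2 τ τ∈Q λ α α∈τ red → ∄ (α , α∈τ , red))

    cond2⇒cond3 : Cond2 Q g θ → Cond3 Q g θ
    cond2⇒cond3 c2 f f∈Q = quotient , f≈lincomb , bounded
      where
      open Division (division f)
      remainder∈Q : remainder ∈Q
      remainder∈Q =
        ∈Q-cancelˡ Q f∈Q (Σₚ-closed Q _ λ r → *-closed (quotient r) (g∈Q r)) decomposition
      f≈lincomb : f ≈ₚ lincomb quotient g
      f≈lincomb α = begin
        coeff f α                                ≈⟨ decomposition α ⟩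
        coeff (lincomb quotient g +ₚ remainder) α ≈⟨ coeff-++ (lincomb quotient g) remainder α ⟩
        coeff (lincomb quotient g) α + coeff remainder α
          ≈⟨ +-congˡ (c2 remainder remainder∈Q remainder-irreducible α) ⟩
        coeff (lincomb quotient g) α + 0#        ≈⟨ +-identityʳ _ ⟩
        coeff (lincomb quotient g) α             ∎
      bounded : ∀ r → SuppSumInΔ (quotient r) (g r) f
      bounded r α α∈ γ γ∈ with quotient-bounded r α α∈
      ... | β , β∈f , α+θ≤β =
        β , β∈f , ≤ₑ-trans {α = α +ₑ γ} {α +ₑ θ r} {β} (+ₑ-monoʳ-≤ₑ α (supp≤θ r γ γ∈)) α+θ≤β

    cond3⇒cond4 : Cond3 Q g θ → Cond4 Q g θ
    cond3⇒cond4 c3 f f∈Q β (β∈f , β-max) with c3 f f∈Q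
    ... | p , f≈ , bounded with ∈supp-lincomb p g {β} (∈supp-resp {f} {lincomb p g} f≈ β∈f)
    ...   | r , α , γ , α∈p , γ∈g , P.refl with bounded r α α∈p (θ r) (θ-∈supp r)
    ...     | β′ , β′∈f , α+θ≤β′ =
      r , subst (θ r ≤ₑ_) (P.sym β≡β′) (≤ₑ-trans {α = θ r} {α +ₑ θ r} {β′} (m≤ₑn+ₑm α (θ r)) α+θ≤β′)
      where
      β≡β′ : α +ₑ γ ≡ β′
      β≡β′ = β-max β′ β′∈f
        (≤ₑ-trans {α = α +ₑ γ} {α +ₑ θ r} {β′} (+ₑ-monoʳ-≤ₑ α (supp≤θ r γ γ∈g)) α+θ≤β′)

    cond3⇒cond5 : Cond3 Q g θ → Cond5 Q g θ
    cond3⇒cond5 c3 f f∈Q with c3 f f∈Q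
    ... | p , f≈ , bounded = p , f≈ , degree-bounded
      where
      degree-bounded : ∀ r → DegSumLe (p r) (g r) f
      degree-bounded r α α∈ γ γ∈ with bounded r α α∈ γ γ∈
      ... | β , β∈f , α+γ≤β =
        β , β∈f , subst (_≤ ∣ β ∣ₑ) (∣∣ₑ-homo-+ₑ α γ) (∣∣ₑ-mono-≤ₑ {α = α +ₑ γ} {β} α+γ≤β)

    cond5⇒cond6 : Cond5 Q g θ → Cond6 Q g θ
    cond5⇒cond6 c5 f f∈Q _ β β∈f (_ , top) with c5 f f∈Q
    ... | p , f≈ , degree-bounded with ∈supp-lincomb p g {β} (∈supp-resp {f} {lincomb p g} f≈ β∈f)
    ...   | r , α , γ , α∈p , γ∈g , P.refl with degree-bounded r α α∈p (θ r) (θ-∈supp r)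
    ...     | β′ , β′∈f , degree≤ = r , subst (λ γ → θ r ≤ₑ (α +ₑ γ)) (P.sym γ≡θ) (m≤ₑn+ₑm α (θ r))
      where
      ∣θ∣≤∣γ∣ : ∣ θ r ∣ₑ ≤ ∣ γ ∣ₑ
      ∣θ∣≤∣γ∣ = ℕ.+-cancelˡ-≤ ∣ α ∣ₑ _ _
        (ℕ.≤-trans degree≤ (ℕ.≤-trans (top β′ β′∈f) (ℕ.≤-reflexive (∣∣ₑ-homo-+ₑ α γ))))
      γ≡θ : γ ≡ θ r
      γ≡θ = ≤ₑ-∣∣ₑ-antisym {α = γ} {θ r} (supp≤θ r γ γ∈g) ∣θ∣≤∣γ∣

    cond4⇒gb : Cond4 Q g θ → GroebnerBasis Q g θ
    cond4⇒gb c4 τ τ∈Q τ≉0 with ∃-maxDegree {τ} τ≉0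
    ... | β , β∈τ , top = β , β∈τ , c4 τ τ∈Q β (maxDegree⇒∈maxsupp {τ} β∈τ top)

    cond6⇒gb : Cond6 Q g θ → GroebnerBasis Q g θ
    cond6⇒gb c6 τ τ∈Q τ≉0 with ∃-maxDegree {τ} τ≉0
    ... | β , β∈τ , top = β , β∈τ , c6 τ τ∈Q τ≉0 β β∈τ ((β , β∈τ , P.refl) , top)

theorem3p1 : {c ℓ ℓq : Level} → ExcludedMiddle (c ⊔ ℓ ⊔ ℓq) →
    (R : CommutativeRing c ℓ) (n : ℕ) (m : ℕ) →
    let open Poly R n in
    (g : Fin m → Ω) (θ : Fin m → Exp n) → (∀ r → MonicWith (g r) (θ r)) →
    (Q : Ideal ℓq) → (∀ r → Ideal._∈Q Q (g r)) →
    (GroebnerBasis Q g θ ⇔ Cond2 Q g θ) × (GroebnerBasis Q g θ ⇔ Cond3 Q g θ) ×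
    (GroebnerBasis Q g θ ⇔ Cond4 Q g θ) × (GroebnerBasis Q g θ ⇔ Cond5 Q g θ) ×
    (GroebnerBasis Q g θ ⇔ Cond6 Q g θ)
theorem3p1 {c} {ℓ} {ℓq} em R n m g θ monic Q g∈Q =
  mk⇔ gb⇒cond2 cond2⇒gb ,
  mk⇔ (cond2⇒cond3 ∘ gb⇒cond2) (cond4⇒gb ∘ cond3⇒cond4) ,
  mk⇔ (cond3⇒cond4 ∘ cond2⇒cond3 ∘ gb⇒cond2) cond4⇒gb ,
  mk⇔ (cond3⇒cond5 ∘ cond2⇒cond3 ∘ gb⇒cond2) (cond6⇒gb ∘ cond5⇒cond6) ,
  mk⇔ (cond5⇒cond6 ∘ cond3⇒cond5 ∘ cond2⇒cond3 ∘ gb⇒cond2) cond6⇒gb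
  where
  open Polynomials.Equivalences R n (em-lower {ℓ} {c ⊔ ℓq} em) g θ monic Q g∈Q
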